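{- Let $n\ge 1$, $A\subseteq\{1,\dots,n\}$ nonempty, $\mathbf p$ a position of $SN(n,A)$ and $r(\mathbf p)$ its reduction. Then every sequence of moves that can be legally performed from $\mathbf p$ can also be legally performed from $r(\mathbf p)$, and vice versa.
   Context: The game $SN(n,A)$ is played on $n$ stacks of tokens; a position is $\mathbf p=(p_1,\dots,p_n)$ of nonnegative integers. A move consists of choosing some $\ell\in A$ and a set of $\ell$ distinct stack indices, each stack having height at least $1$, and removing exactly one token from each chosen stack; a sequence of moves (a sequence of such index sets) is legal from a position if each move is legal in the position reached so far. A terminal position is one with no legal move. For a position $\mathbf p$, let $\mathcal T(\mathbf p)$ be the set of terminal positions reachable from $\mathbf p$ by finite sequences of legal moves, $u_i(\mathbf p)=\min\{t_i:\mathbf t\in\mathcal T(\mathbf p)\}$, and $r(\mathbf p)=\mathbf p-u(\mathbf p)$. -}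

module Defs where

open import Data.Nat using (ℕ; zero; suc; _∸_; _≤_)
open import Data.Fin using (Fin)
open import Data.Fin.Subset using (Subset; _∈_; ∣_∣)
open import Data.Vec using (lookup)
open import Data.Bool using (true; false)
open import Data.List using (List; []; _∷_)
open import Data.Product using (Σ; _×_; _,_)
open import Relation.Nullary using (¬_)
open import Relation.Binary.PropositionalEquality using (_≡_)

-- A position of SN(n,A): the heights of the n stacks.
Position : ℕ → Set
Position n = Fin n → ℕ

-- A move is the set of chosen stack indices (distinctness is automatic
-- for a subset); it is legal in p for the game with allowed sizes A
-- if its cardinality lies in A and every chosen stack is nonempty.
LegalMove : ∀ {n} → (ℕ → Set) → Position n → Subset n → Set
LegalMove {n} A p S = A ∣ S ∣ × (∀ (i : Fin n) → i ∈ S → 1 ≤ p i)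

applyMove : ∀ {n} → Position n → Subset n → Position n
applyMove p S i with lookup S i
... | true  = p i ∸ 1
... | false = p i

data LegalSeq {n} (A : ℕ → Set) : Position n → List (Subset n) → Set where
  []  : ∀ {p} → LegalSeq A p []
  _∷_ : ∀ {p S ms} → LegalMove A p S → LegalSeq A (applyMove p S) ms →
        LegalSeq A p (S ∷ ms)

applySeq : ∀ {n} → Position n → List (Subset n) → Position n
applySeq p []       = p
applySeq p (S ∷ ms) = applySeq (applyMove p S) ms

Terminal : ∀ {n} → (ℕ → Set) → Position n → Set
Terminal A t = ∀ S → ¬ LegalMove A t S

ReachableTerminal : ∀ {n} → (ℕ → Set) → Position n → Position n → Set
ReachableTerminal {n} A p t =
  Terminal A t × Σ (List (Subset n)) (λ ms → LegalSeq A p ms × applySeq p ms ≡ t)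

-- u is u(p): u_i = min { t_i : t ∈ 𝒯(p) } for every i
-- (the minimum is attained and is a lower bound).
IsU : ∀ {n} → (ℕ → Set) → Position n → Position n → Set
IsU {n} A p u = ∀ (i : Fin n) →
  Σ (Position n) (λ t → ReachableTerminal A p t × t i ≡ u i)
  × (∀ t → ReachableTerminal A p t → u i ≤ t i)

reduction : ∀ {n} → Position n → Position n → Position n
reduction p u i = p i ∸ u i

-- Legality of a sequence of moves is monotone in the position, so r(p) ≤ p
-- gives one direction. For the other, let q be the position reached by a legal
-- sequence from p. Every move removes at least one token, so some terminal
-- t ≤ q is reachable from q, hence from p, and u(p) ≤ t ≤ q. Thus r(p) holds
-- at least as many tokens on each stack as the sequence takes from p, which
-- is all the sequence needs.
module Submission where

open import Defs
open import Data.Nat using (ℕ; zero; suc; _+_; _∸_; _≤_; _<_; _≤?_; z<s)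
open import Data.Nat.Properties
open import Data.Nat.Induction using (<-wellFounded)
open import Data.Fin using (zero; suc)
open import Data.Fin.Subset using (Subset; _∈_; ∣_∣; Nonempty)
open import Data.Fin.Subset.Properties using (nonempty?; Empty-unique; ∣⊥∣≡0)
open import Data.Vec using (lookup)
open import Data.Vec.Properties using ([]=⇒lookup; lookup⇒[]=)
open import Data.Bool using (true; false)
open import Data.List using (List; []; _∷_; _++_)
open import Data.Product using (Σ; _×_; _,_; proj₁; proj₂)
open import Function using (_∘_; _on_)
open import Induction.WellFounded using (Acc; acc)
open import Relation.Binary.Construct.On as On using ()
open import Relation.Nullary using (¬_; yes; no; contradiction)
open import Relation.Nullary.Decidable using (decidable-stable)
open import Relation.Binary.PropositionalEquality using (_≡_; refl; trans; cong)

_≤ᴾ_ : ∀ {n} → Position n → Position n → Set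
p ≤ᴾ q = ∀ i → p i ≤ q i

total : ∀ {n} → Position n → ℕ
total {zero}  p = 0
total {suc n} p = p zero + total (λ i → p (suc i))

total-mono-≤ : ∀ {n} {p q : Position n} → p ≤ᴾ q → total p ≤ total q
total-mono-≤ {zero}  p≤q = ≤-refl
total-mono-≤ {suc n} p≤q = +-mono-≤ (p≤q zero) (total-mono-≤ (λ i → p≤q (suc i)))

total-mono-< : ∀ {n} {p q : Position n} → p ≤ᴾ q → ∀ j → p j < q j → total p < total q
total-mono-< p≤q zero    pj<qj = +-mono-<-≤ pj<qj (total-mono-≤ (λ i → p≤q (suc i)))
total-mono-< p≤q (suc j) pj<qj =
  +-mono-≤-< (p≤q zero) (total-mono-< (λ i → p≤q (suc i)) j pj<qj)

nonempty-if-∣∣≥1 : ∀ {n} (S : Subset n) → 1 ≤ ∣ S ∣ → Nonempty S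
nonempty-if-∣∣≥1 {n} S 1≤∣S∣ with nonempty? S
... | yes ne = ne
... | no ¬ne = contradiction ∣S∣≡0 (>⇒≢ 1≤∣S∣)
  where
  ∣S∣≡0 : ∣ S ∣ ≡ 0
  ∣S∣≡0 = trans (cong ∣_∣ (Empty-unique ¬ne)) (∣⊥∣≡0 n)

applyMove-∈ : ∀ {n} (p : Position n) {S i} → i ∈ S → applyMove p S i ≡ p i ∸ 1
applyMove-∈ p {S} {i} i∈S rewrite []=⇒lookup i∈S = refl

applyMove-≤ : ∀ {n} (p : Position n) S → applyMove p S ≤ᴾ p
applyMove-≤ p S i with lookup S i
... | true  = m∸n≤m (p i) 1
... | false = ≤-refl

applyMove-< : ∀ {n} (p : Position n) {S i} → i ∈ S → 1 ≤ p i → applyMove p S i < p i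
applyMove-< p {S} {i} i∈S 1≤p = begin-strict
  applyMove p S i  ≡⟨ applyMove-∈ p i∈S ⟩
  p i ∸ 1          <⟨ ∸-monoʳ-< ≤-refl 1≤p ⟩
  p i              ∎
  where open ≤-Reasoning

applyMove-mono : ∀ {n} {p q : Position n} S → p ≤ᴾ q → applyMove p S ≤ᴾ applyMove q S
applyMove-mono S p≤q i with lookup S i
... | true  = ∸-monoˡ-≤ 1 (p≤q i)
... | false = p≤q i

total-applyMove-< : ∀ {n} {q : Position n} {S} → Nonempty S → (∀ i → i ∈ S → 1 ≤ q i) →
  total (applyMove q S) < total q
total-applyMove-< {q = q} {S} (i , i∈S) stacks =
  total-mono-< (applyMove-≤ q S) i (applyMove-< q i∈S (stacks i i∈S))

applySeq-≤ : ∀ {n} (p : Position n) ms → applySeq p ms ≤ᴾ p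
applySeq-≤ p []       i = ≤-refl
applySeq-≤ p (S ∷ ms) i = ≤-trans (applySeq-≤ (applyMove p S) ms i) (applyMove-≤ p S i)

applySeq-++ : ∀ {n} (p : Position n) ms ns → applySeq p (ms ++ ns) ≡ applySeq (applySeq p ms) ns
applySeq-++ p []       ns = refl
applySeq-++ p (S ∷ ms) ns = applySeq-++ (applyMove p S) ms ns

legalSeq-++ : ∀ {n A} {p : Position n} {ms ns} →
  LegalSeq A p ms → LegalSeq A (applySeq p ms) ns → LegalSeq A p (ms ++ ns)
legalSeq-++ []            legal-ns = legal-ns
legalSeq-++ (move ∷ rest) legal-ns = move ∷ legalSeq-++ rest legal-ns

legalSeq-mono : ∀ {n A} {p q : Position n} {ms} → p ≤ᴾ q → LegalSeq A p ms → LegalSeq A q ms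
legalSeq-mono p≤q [] = []
legalSeq-mono {ms = S ∷ _} p≤q ((size , stacks) ∷ rest) =
  (size , λ i i∈S → ≤-trans (stacks i i∈S) (p≤q i)) ∷ legalSeq-mono (applyMove-mono S p≤q) rest

m≤n+o∧o<m⇒0<n : ∀ {m n o} → m ≤ n + o → o < m → 0 < n
m≤n+o∧o<m⇒0<n {n = zero}  m≤o o<m = contradiction m≤o (<⇒≱ o<m)
m≤n+o∧o<m⇒0<n {n = suc _} _   _   = z<s

m≤n+o∧0<n⇒m∸1≤n∸1+o : ∀ {m n o} → m ≤ n + o → 0 < n → m ∸ 1 ≤ (n ∸ 1) + o
m≤n+o∧0<n⇒m∸1≤n∸1+o {n = suc _} m≤n+o _ = ∸-monoˡ-≤ 1 m≤n+o

-- r is only required to hold what the sequence takes from each stack of p,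
-- stated additively to avoid truncated subtraction.
legalSeq-transfer : ∀ {n A} {p r : Position n} {ms} → LegalSeq A p ms →
  (∀ i → p i ≤ r i + applySeq p ms i) → LegalSeq A r ms
legalSeq-transfer [] _ = []
legalSeq-transfer {p = p} {r} {S ∷ ms} ((size , stacks) ∷ rest) p≤r+q =
  (size , r-nonempty) ∷ legalSeq-transfer rest p′≤r′+q
  where
  q = applySeq (applyMove p S) ms

  q<p : ∀ {i} → i ∈ S → q i < p i
  q<p {i} i∈S = ≤-<-trans (applySeq-≤ (applyMove p S) ms i) (applyMove-< p i∈S (stacks i i∈S))

  r-nonempty : ∀ i → i ∈ S → 0 < r i
  r-nonempty i i∈S = m≤n+o∧o<m⇒0<n (p≤r+q i) (q<p i∈S)

  p′≤r′+q : ∀ i → applyMove p S i ≤ applyMove r S i + q i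
  p′≤r′+q i with lookup S i in S[i]
  ... | true  = m≤n+o∧0<n⇒m∸1≤n∸1+o (p≤r+q i) (r-nonempty i (lookup⇒[]= i S S[i]))
  ... | false = p≤r+q i

-- Only ¬¬ holds constructively: whether a position is terminal depends on
-- the arbitrary predicate A.
terminal-reachable : ∀ {n A} → (∀ l → A l → 1 ≤ l) → (q : Position n) →
  ¬ ¬ Σ (Position n) (ReachableTerminal A q)
terminal-reachable {n} {A} sizes⁺ q = go q (On.wellFounded total <-wellFounded q)
  where
  go : ∀ q → Acc (_<_ on total) q → ¬ ¬ Σ (Position n) (ReachableTerminal A q)
  go q (acc smaller) none = none (q , terminal , [] , [] , refl)
    where
    terminal : Terminal A q
    terminal S move@(size , stacks) =
      go (applyMove q S) (smaller (total-applyMove-< (nonempty-if-∣∣≥1 S (sizes⁺ _ size)) stacks))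
        λ where (t , t-terminal , ns , legal , refl) → none (t , t-terminal , S ∷ ns , move ∷ legal , refl)

u≤applySeq : ∀ {n A} {p u : Position n} {ms} → (∀ l → A l → 1 ≤ l) → IsU A p u →
  LegalSeq A p ms → u ≤ᴾ applySeq p ms
u≤applySeq {n} {A} {p} {u} {ms} sizes⁺ isU legal i =
  decidable-stable (u i ≤? q i) λ u≰q → terminal-reachable sizes⁺ q (u≰q ∘ u≤reachableTerminal)
  where
  q = applySeq p ms

  u≤reachableTerminal : Σ (Position n) (ReachableTerminal A q) → u i ≤ q i
  u≤reachableTerminal (t , t-terminal , ns , legal-ns , refl) = ≤-trans
    (proj₂ (isU i) t (t-terminal , ms ++ ns , legalSeq-++ legal legal-ns , applySeq-++ p ms ns))
    (applySeq-≤ q ns i)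

lemma1 : (n : ℕ) → 1 ≤ n → (A : ℕ → Set) →
    (∀ l → A l → 1 ≤ l × l ≤ n) → Σ ℕ A →
    (p u : Position n) → IsU A p u →
    (ms : List (Subset n)) →
    (LegalSeq A p ms → LegalSeq A (reduction p u) ms)
    × (LegalSeq A (reduction p u) ms → LegalSeq A p ms)
lemma1 n _ A sizes _ p u isU ms = forward , legalSeq-mono (λ i → m∸n≤m (p i) (u i))
  where
  r = reduction p u

  forward : LegalSeq A p ms → LegalSeq A r ms
  forward legal = legalSeq-transfer legal λ i → begin
    p i                      ≤⟨ m≤n+m∸n (p i) (u i) ⟩
    u i + r i                ≤⟨ +-monoˡ-≤ (r i) (u≤applySeq (λ l a → proj₁ (sizes l a)) isU legal i) ⟩
    applySeq p ms i + r i    ≡⟨ +-comm (applySeq p ms i) (r i) ⟩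
    r i + applySeq p ms i    ∎
    where open ≤-Reasoning
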